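{- Let $k\ge 1$. Suppose the QCSP instance $(\theta,\mathbf{B})$ is $k$-judge-consistent, $\mathbf{B}$ is a finite structure, and $\theta'$ is a qc-sentence obtained from $\theta$ by applying to some subformula of $\theta$ one of the following syntactic transformations: (1) $\bigwedge_{i\in I}\phi_i \leadsto (\bigwedge_{j\in J}\phi_j)\wedge(\bigwedge_{k\in K}\phi_k)$, where $I$ is the disjoint union of $J$ and $K$; (2) $Qv\,(\phi\wedge\psi)\leadsto (Qv\,\phi)\wedge\psi$, where $Q$ is a quantifier and $v\notin\mathrm{free}(\psi)$; (3) $\forall y\,\bigwedge_{i\in I}\phi_i\leadsto\bigwedge_{i\in I}(\forall y\,\phi_i)$. Then the QCSP instance $(\theta',\mathbf{B})$ is $k$-judge-consistent.
   Context: Multi-sorted relational first-order logic: structures $\mathbf{B}$ have sort universes $B_s$ and relations $R^{\mathbf{B}}$; variables have sorts $s(v)$; a "map $f:V\to B$" sends each $v\in V$ into $B_{s(v)}$; $f\upharpoonright U$ is restriction and $f[y\to b]$ the extension mapping $y$ to $b$. A qc-formula is built from atoms, conjunction (arbitrary finite arity), $\forall,\exists$; $\mathrm{free}(\phi)$ denotes free variables; a QCSP instance $(\theta,\mathbf{B})$ is a qc-sentence with a structure of the same signature. $I_\theta$ has one index per subformula occurrence of $\theta$, $\theta(i)$ is the subformula at $i$, parent/child refer to the syntax tree. A judgement is $(i,V,F)$ with $i\in I_\theta$, $V\subseteq\mathrm{free}(\theta(i))$, $F$ a set of maps $V\to B$ (exactly one map $\emptyset\to B$ exists); empty if $F=\emptyset$;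 width $|V|$. $F_1\Join F_2=\{f:U_1\cup U_2\to B: f\upharpoonright U_1\in F_1, f\upharpoonright U_2\in F_2\}$; for $y\in U$, $\epsilon_yF=\{f:U\setminus\{y\}\to B: f[y\to b]\in F$ for all $b\in B_{s(y)}\}$. A judgement proof is a finite sequence of judgements each of one of the types: (atom) $(i,\{v_1,\dots,v_k\},F)$ with $\theta(i)=R(v_1,\dots,v_k)$, $F=\{f:(f(v_1),\dots,f(v_k))\in R^{\mathbf{B}}\}$; (projection) $(i,U,F\upharpoonright U)$ from previous $(i,V,F)$, $U\subseteq V$; (join) $(i,U_1\cup U_2,F_1\Join F_2)$ from previous $(i,U_1,F_1),(i,U_2,F_2)$; (upward flow) $(i,V,F)$ from previous $(j,V,F)$, $i$ parent of $j$; ($\forall$-elimination) $(i,V\setminus\{y\},\epsilon_yF)$ from previous $(j,V,F)$, $y\in V$, $\theta(i)=\forall y\,\theta(j)$, $i$ parent of $j$; (downward flow) $(j,V,F)$ from previous $(i,V,F)$, $i$ parent of $j$. Width of a proof = maximum width of its judgements. $(\theta,\mathbf{B})$ is $k$-judge-consistent if no judgement proof of width at most $k$ contains an empty judgement. -}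

module Defs where

open import Level using (Level; 0ℓ) renaming (suc to lsuc)
open import Data.Nat using (ℕ; _≤_)
open import Data.Fin using (Fin)
open import Data.Bool using (Bool; true; false; T; _∨_; not)
open import Data.Bool.Properties using (T-∨)
open import Data.Unit using (⊤; tt)
open import Data.Empty using (⊥; ⊥-elim)
open import Data.Product using (Σ; ∃; _×_; _,_; proj₁; proj₂)
open import Data.Sum using (_⊎_; inj₁; inj₂)
open import Data.List using (List; []; _∷_; _++_; map; filter; length; deduplicate)
open import Data.List.Membership.Propositional using (_∈_)
open import Data.List.Relation.Unary.All using (All)
open import Data.List.Relation.Unary.Any using (Any)
open import Data.List.Relation.Binary.Permutation.Propositional using (_↭_)
open import Relation.Nullary using (¬_; Dec; yes; no; ¬?)
open import Relation.Nullary.Decidable using (⌊_⌋)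
open import Relation.Binary.Definitions using (DecidableEquality)
open import Relation.Binary.PropositionalEquality using (_≡_; refl; subst; sym)
open import Function using (_∘_)
open import Function.Bundles using (_↔_)

record Signature : Set₁ where
  field
    Sort  : Set
    Var   : Set
    _≟_   : DecidableEquality Var
    sort  : Var → Sort
    Rel   : Set
    arity : Rel → List Sort

Tuple : {Sort : Set} → (Sort → Set) → List Sort → Set
Tuple U []       = ⊤
Tuple U (s ∷ ss) = U s × Tuple U ss

module QCSP (sig : Signature) where
  open Signature sig public

  record Structure : Set₁ where
    field
      U   : Sort → Set
      rel : (r : Rel) → Tuple U (arity r) → Set

  open Structure public

  Finite : Structure → Set
  Finite B = (s : Sort) → ∃ λ (n : ℕ) → U B s ↔ Fin n

  data Quant : Set where
    ∀Q ∃Q : Quant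

  data Formula : Set where
    atom  : (r : Rel) (vs : List Var) → map sort vs ≡ arity r → Formula
    conj  : List Formula → Formula
    quant : Quant → Var → Formula → Formula

  -- finite sets of variables are represented by lists; membership is
  -- the (proof-irrelevant) boolean test
  elem : Var → List Var → Bool
  elem v []       = false
  elem v (x ∷ xs) = ⌊ v ≟ x ⌋ ∨ elem v xs

  _∈ᵥ_ : Var → List Var → Set
  v ∈ᵥ V = T (elem v V)

  _⊆ᵥ_ : List Var → List Var → Set
  U ⊆ᵥ V = (v : Var) → v ∈ᵥ U → v ∈ᵥ V

  removeᵥ : Var → List Var → List Var
  removeᵥ y []       = []
  removeᵥ y (x ∷ xs) with x ≟ y
  ... | yes _ = removeᵥ y xs
  ... | no  _ = x ∷ removeᵥ y xs

  width : List Var → ℕ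
  width V = length (deduplicate _≟_ V)

  mutual
    free : Formula → List Var
    free (atom r vs _)   = vs
    free (conj φs)       = freeList φs
    free (quant q y φ)   = removeᵥ y (free φ)

    freeList : List Formula → List Var
    freeList []       = []
    freeList (φ ∷ φs) = free φ ++ freeList φs

  Sentence : Formula → Set
  Sentence θ = free θ ≡ []

  -- Subformula occurrences I_θ (positions in the syntax tree)

  lookupF : (φs : List Formula) → Fin (length φs) → Formula
  lookupF (φ ∷ φs) Fin.zero    = φ
  lookupF (φ ∷ φs) (Fin.suc j) = lookupF φs j

  data Pos : Formula → Set where
    here   : ∀ {φ} → Pos φ
    inConj : ∀ {φs} (j : Fin (length φs)) → Pos (lookupF φs j) → Pos (conj φs)
    inQ    : ∀ {q y φ} → Pos φ → Pos (quant q y φ)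

  subAt : (θ : Formula) → Pos θ → Formula
  subAt θ              here         = θ
  subAt (conj φs)      (inConj j p) = subAt (lookupF φs j) p
  subAt (quant q y φ)  (inQ p)      = subAt φ p

  -- Child i j : i is the parent of j
  data Child : {θ : Formula} → Pos θ → Pos θ → Set where
    conj-here : ∀ {φs} (j : Fin (length φs)) → Child {conj φs} here (inConj j here)
    q-here    : ∀ {q y φ} → Child {quant q y φ} here (inQ here)
    conj-step : ∀ {φs} {j : Fin (length φs)} {p p'} →
                Child p p' → Child {conj φs} (inConj j p) (inConj j p')
    q-step    : ∀ {q y φ} {p p' : Pos φ} →
                Child p p' → Child {quant q y φ} (inQ p) (inQ p')

  module _ (B : Structure) where

    Map : List Var → Set
    Map V = (v : Var) → v ∈ᵥ V → U B (sort v)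

    MapSet : List Var → Set₁
    MapSet V = Map V → Set

    private
      ∈-here : ∀ x xs → x ∈ᵥ (x ∷ xs)
      ∈-here x xs with x ≟ x
      ... | yes _ = tt
      ... | no ¬p = ⊥-elim (¬p refl)

      ∈-there : ∀ v x xs → v ∈ᵥ xs → v ∈ᵥ (x ∷ xs)
      ∈-there v x xs p = Function.Equivalence.from T-∨ (inj₂ p)
        where import Function.Bundles as Function

    tup : (vs : List Var) → Map vs → Tuple (U B) (map sort vs)
    tup []       f = tt
    tup (x ∷ xs) f = f x (∈-here x xs) , tup xs (λ v p → f v (∈-there v x xs p))

    atomSet : (r : Rel) (vs : List Var) (eq : map sort vs ≡ arity r) → MapSet vs
    atomSet r vs eq f = rel B r (subst (Tuple (U B)) eq (tup vs f))

    restrictSet : (V W : List Var) → W ⊆ᵥ V → MapSet V → MapSet W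
    restrictSet V W W⊆V F g = ∃ λ f → F f × ((v : Var) (p : v ∈ᵥ W) → f v (W⊆V v p) ≡ g v p)

    private
      ∈-++ˡ : ∀ v (U₁ U₂ : List Var) → v ∈ᵥ U₁ → v ∈ᵥ (U₁ ++ U₂)
      ∈-++ˡ v (x ∷ xs) U₂ p with ⌊ v ≟ x ⌋
      ... | true  = tt
      ... | false = ∈-++ˡ v xs U₂ p

      ∈-++ʳ : ∀ v (U₁ U₂ : List Var) → v ∈ᵥ U₂ → v ∈ᵥ (U₁ ++ U₂)
      ∈-++ʳ v []       U₂ p = p
      ∈-++ʳ v (x ∷ xs) U₂ p with ⌊ v ≟ x ⌋
      ... | true  = tt
      ... | false = ∈-++ʳ v xs U₂ p

    -- F₁ ⋈ F₂ (on U₁ ∪ U₂, represented by U₁ ++ U₂)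
    joinSet : (U₁ U₂ : List Var) → MapSet U₁ → MapSet U₂ → MapSet (U₁ ++ U₂)
    joinSet U₁ U₂ F₁ F₂ f =
      F₁ (λ v p → f v (∈-++ˡ v U₁ U₂ p)) × F₂ (λ v p → f v (∈-++ʳ v U₁ U₂ p))

    private
      ∈-remove : ∀ v y (V : List Var) → v ∈ᵥ V → ¬ (v ≡ y) → v ∈ᵥ removeᵥ y V
      ∈-remove v y (x ∷ xs) p v≢y with x ≟ y
      ... | yes x≡y = ∈-remove v y xs (tail-of p (λ v≡x → v≢y (Relation.Binary.PropositionalEquality.trans v≡x x≡y))) v≢y
        where
          tail-of : v ∈ᵥ (x ∷ xs) → ¬ (v ≡ x) → v ∈ᵥ xs
          tail-of q v≢x with v ≟ x
          ... | yes e = ⊥-elim (v≢x e)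
          ... | no  _ = q
      ... | no  _   with v ≟ x
      ...   | yes _ = tt
      ...   | no  _ = ∈-remove v y xs p v≢y

    extend : (V : List Var) (y : Var) → Map (removeᵥ y V) → U B (sort y) → Map V
    extend V y g b v p with v ≟ y
    ... | yes v≡y = subst (U B ∘ sort) (sym v≡y) b
    ... | no  v≢y = g v (∈-remove v y V p v≢y)

    εSet : (V : List Var) (y : Var) → MapSet V → MapSet (removeᵥ y V)
    εSet V y F g = (b : U B (sort y)) → F (extend V y g b)

  module _ (θ : Formula) (B : Structure) where

    record Judgement : Set₁ where
      constructor judgement
      field
        pos  : Pos θ
        vars : List Var
        wf   : vars ⊆ᵥ free (subAt θ pos)
        F    : MapSet B vars

    open Judgement public

    EmptyJ : Judgement → Set
    EmptyJ J = (f : Map B (vars J)) → ¬ F J f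

    data Step (js : List Judgement) : Judgement → Set₁ where
      atomS : (i : Pos θ) (r : Rel) (vs : List Var) (eq : map sort vs ≡ arity r) →
              subAt θ i ≡ atom r vs eq →
              (wf : vs ⊆ᵥ free (subAt θ i)) →
              Step js (judgement i vs wf (atomSet B r vs eq))
      projS : ∀ {J} → J ∈ js → (W : List Var) (W⊆V : W ⊆ᵥ vars J) →
              (wf : W ⊆ᵥ free (subAt θ (pos J))) →
              Step js (judgement (pos J) W wf (restrictSet B (vars J) W W⊆V (F J)))
      joinS : ∀ {J₁ J₂} → J₁ ∈ js → J₂ ∈ js → (same : pos J₁ ≡ pos J₂) →
              (wf : (vars J₁ ++ vars J₂) ⊆ᵥ free (subAt θ (pos J₁))) →
              Step js (judgement (pos J₁) (vars J₁ ++ vars J₂) wf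
                        (joinSet B (vars J₁) (vars J₂) (F J₁) (F J₂)))
      upS   : ∀ {J} → J ∈ js → (i : Pos θ) → Child i (pos J) →
              (wf : vars J ⊆ᵥ free (subAt θ i)) →
              Step js (judgement i (vars J) wf (F J))
      ∀elimS : ∀ {J} → J ∈ js → (i : Pos θ) → Child i (pos J) →
              (y : Var) → subAt θ i ≡ quant ∀Q y (subAt θ (pos J)) →
              y ∈ᵥ vars J →
              (wf : removeᵥ y (vars J) ⊆ᵥ free (subAt θ i)) →
              Step js (judgement i (removeᵥ y (vars J)) wf (εSet B (vars J) y (F J)))
      downS : ∀ {J} → J ∈ js → (j : Pos θ) → Child (pos J) j →
              (wf : vars J ⊆ᵥ free (subAt θ j)) →
              Step js (judgement j (vars J) wf (F J))

    -- A judgement proof, stored newest-first: each judgement is justified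
    -- by the judgements occurring before it in the sequence.
    data Proof : List Judgement → Set₁ where
      []  : Proof []
      _▷_ : ∀ {js J} → Proof js → Step js J → Proof (J ∷ js)

    JudgeConsistent : ℕ → Set₁
    JudgeConsistent k =
      (js : List Judgement) → Proof js →
      All (λ J → width (vars J) ≤ k) js → ¬ Any EmptyJ js

  data Transform : Formula → Formula → Set where
    split   : ∀ {φs φJ φK} → φs ↭ (φJ ++ φK) →
              Transform (conj φs) (conj (conj φJ ∷ conj φK ∷ []))
    pullOut : ∀ q v φ ψ → ¬ (v ∈ᵥ free ψ) →
              Transform (quant q v (conj (φ ∷ ψ ∷ [])))
                        (conj (quant q v φ ∷ ψ ∷ []))
    distrib : ∀ y φs →
              Transform (quant ∀Q y (conj φs)) (conj (map (quant ∀Q y) φs))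

  data Rewrite : Formula → Formula → Set where
    root    : ∀ {φ ψ} → Transform φ ψ → Rewrite φ ψ
    inConjR : ∀ xs {φ ψ} ys → Rewrite φ ψ →
              Rewrite (conj (xs ++ φ ∷ ys)) (conj (xs ++ ψ ∷ ys))
    inQR    : ∀ q y {φ ψ} → Rewrite φ ψ → Rewrite (quant q y φ) (quant q y ψ)

-- Each rewrite θ ↝ θ' comes with a map σ from the subformula occurrences of
-- θ' to those of θ that sends atoms to the same atoms, can only enlarge free
-- variable sets, and turns every parent–child edge of θ' into a path of
-- length at most two in θ along which a judgement can still flow (a ∀-edge
-- into a path ending in a ∀-edge). Replaying a judgement proof of θ' along σ,
-- with an extra flow step wherever an edge became a path of length two, yields
-- a judgement proof of θ in which every judgement (i , V , F) of θ' reappears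
-- as (σ i , V , F). Widths and emptiness are thus preserved, and an empty
-- judgement of width ≤ k for θ' gives one for θ.
module Submission where

open import Defs
open import Data.Nat using (ℕ; _≤_)
open import Data.Fin using (Fin; zero; suc)
open import Data.Unit using (tt)
open import Data.Empty using (⊥-elim)
open import Data.Product using (∃; _×_; _,_; proj₁; proj₂)
open import Data.Sum using (_⊎_; inj₁; inj₂)
open import Data.List using (List; []; _∷_; _++_; map; length)
open import Data.List.Membership.Propositional using (_∈_; find; lose)
open import Data.List.Membership.Propositional.Properties using (∈-++⁺ˡ; ∈-++⁺ʳ; ∈-++⁻)
open import Data.List.Relation.Unary.All as All using (All; []; _∷_)
open import Data.List.Relation.Unary.Any using (here; there)
open import Data.List.Relation.Binary.Permutation.Propositional using (↭-sym)
open import Data.List.Relation.Binary.Permutation.Propositional.Properties using (∈-resp-↭)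
open import Relation.Nullary using (¬_; yes; no)
open import Relation.Binary.PropositionalEquality using (_≡_; refl; subst; sym; cong)

module _ (sig : Signature) where
  open QCSP sig

  ∈ᵥ-here : ∀ x xs → x ∈ᵥ (x ∷ xs)
  ∈ᵥ-here x xs with x ≟ x
  ... | yes _ = tt
  ... | no x≢x = ⊥-elim (x≢x refl)

  ∈ᵥ-there : ∀ {v} x xs → v ∈ᵥ xs → v ∈ᵥ (x ∷ xs)
  ∈ᵥ-there {v} x xs v∈ with v ≟ x
  ... | yes _ = tt
  ... | no _ = v∈

  ∈ᵥ-∷⁻ : ∀ {v} x xs → v ∈ᵥ (x ∷ xs) → v ≡ x ⊎ v ∈ᵥ xs
  ∈ᵥ-∷⁻ {v} x xs v∈ with v ≟ x
  ... | yes v≡x = inj₁ v≡x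
  ... | no _ = inj₂ v∈

  ∈ᵥ-++⁺ˡ : ∀ {v} U W → v ∈ᵥ U → v ∈ᵥ (U ++ W)
  ∈ᵥ-++⁺ˡ (x ∷ xs) W v∈ with ∈ᵥ-∷⁻ x xs v∈
  ... | inj₁ refl = ∈ᵥ-here x (xs ++ W)
  ... | inj₂ v∈xs = ∈ᵥ-there x (xs ++ W) (∈ᵥ-++⁺ˡ xs W v∈xs)

  ∈ᵥ-++⁺ʳ : ∀ {v} U W → v ∈ᵥ W → v ∈ᵥ (U ++ W)
  ∈ᵥ-++⁺ʳ [] W v∈ = v∈
  ∈ᵥ-++⁺ʳ (x ∷ xs) W v∈ = ∈ᵥ-there x (xs ++ W) (∈ᵥ-++⁺ʳ xs W v∈)

  ∈ᵥ-++⁻ : ∀ {v} U W → v ∈ᵥ (U ++ W) → v ∈ᵥ U ⊎ v ∈ᵥ W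
  ∈ᵥ-++⁻ [] W v∈ = inj₂ v∈
  ∈ᵥ-++⁻ (x ∷ xs) W v∈ with ∈ᵥ-∷⁻ x (xs ++ W) v∈
  ... | inj₁ refl = inj₁ (∈ᵥ-here x xs)
  ... | inj₂ v∈′ with ∈ᵥ-++⁻ xs W v∈′
  ...   | inj₁ v∈xs = inj₁ (∈ᵥ-there x xs v∈xs)
  ...   | inj₂ v∈W = inj₂ v∈W

  ∈ᵥ-removeᵥ⁺ : ∀ {v} y V → v ∈ᵥ V → ¬ v ≡ y → v ∈ᵥ removeᵥ y V
  ∈ᵥ-removeᵥ⁺ y (x ∷ xs) v∈ v≢y with x ≟ y | ∈ᵥ-∷⁻ x xs v∈
  ... | yes refl | inj₁ refl = ⊥-elim (v≢y refl)
  ... | yes _    | inj₂ v∈xs = ∈ᵥ-removeᵥ⁺ y xs v∈xs v≢y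
  ... | no _     | inj₁ refl = ∈ᵥ-here x (removeᵥ y xs)
  ... | no _     | inj₂ v∈xs = ∈ᵥ-there x (removeᵥ y xs) (∈ᵥ-removeᵥ⁺ y xs v∈xs v≢y)

  ∈ᵥ-removeᵥ⁻ : ∀ {v} y V → v ∈ᵥ removeᵥ y V → v ∈ᵥ V × ¬ v ≡ y
  ∈ᵥ-removeᵥ⁻ y (x ∷ xs) v∈ with x ≟ y
  ... | yes _ = let v∈xs , v≢y = ∈ᵥ-removeᵥ⁻ y xs v∈ in ∈ᵥ-there x xs v∈xs , v≢y
  ... | no x≢y with ∈ᵥ-∷⁻ x (removeᵥ y xs) v∈
  ...   | inj₁ refl = ∈ᵥ-here x xs , x≢y
  ...   | inj₂ v∈′ = let v∈xs , v≢y = ∈ᵥ-removeᵥ⁻ y xs v∈′ in ∈ᵥ-there x xs v∈xs , v≢y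

  removeᵥ-mono : ∀ y U V → U ⊆ᵥ V → removeᵥ y U ⊆ᵥ removeᵥ y V
  removeᵥ-mono y U V U⊆V v v∈ =
    let v∈U , v≢y = ∈ᵥ-removeᵥ⁻ y U v∈ in ∈ᵥ-removeᵥ⁺ y V (U⊆V v v∈U) v≢y

  free-lookupF-⊆ : ∀ φs j → free (lookupF φs j) ⊆ᵥ freeList φs
  free-lookupF-⊆ (φ ∷ φs) zero v v∈ = ∈ᵥ-++⁺ˡ (free φ) (freeList φs) v∈
  free-lookupF-⊆ (φ ∷ φs) (suc j) v v∈ =
    ∈ᵥ-++⁺ʳ (free φ) (freeList φs) (free-lookupF-⊆ φs j v v∈)

  ∈ᵥ-freeList⁻ : ∀ φs {v} → v ∈ᵥ freeList φs → ∃ λ j → v ∈ᵥ free (lookupF φs j)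
  ∈ᵥ-freeList⁻ (φ ∷ φs) v∈ with ∈ᵥ-++⁻ (free φ) (freeList φs) v∈
  ... | inj₁ v∈φ = zero , v∈φ
  ... | inj₂ v∈φs = let j , v∈j = ∈ᵥ-freeList⁻ φs v∈φs in suc j , v∈j

  lookupF-∈ : ∀ φs j → lookupF φs j ∈ φs
  lookupF-∈ (φ ∷ φs) zero = here refl
  lookupF-∈ (φ ∷ φs) (suc j) = there (lookupF-∈ φs j)

  ∈⇒lookupF : ∀ {φ φs} → φ ∈ φs → ∃ λ j → lookupF φs j ≡ φ
  ∈⇒lookupF (here refl) = zero , refl
  ∈⇒lookupF (there φ∈) = let j , e = ∈⇒lookupF φ∈ in suc j , e

  lookupF-map : ∀ f φs j → ∃ λ j′ → lookupF (map f φs) j ≡ f (lookupF φs j′)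
  lookupF-map f (φ ∷ φs) zero = zero , refl
  lookupF-map f (φ ∷ φs) (suc j) = let j′ , e = lookupF-map f φs j in suc j′ , e

  quant-prefix-≡ : ∀ {q q′ y z φ′ φ} → quant q y φ′ ≡ quant q′ z φ′ → quant q y φ ≡ quant q′ z φ
  quant-prefix-≡ refl = refl

  -- In the via cases a judgement travels through m; the side condition keeps
  -- it well formed there.
  data FlowPath (θ : Formula) (a b : Pos θ) : Set where
    stay : a ≡ b → FlowPath θ a b
    edge : Child a b → FlowPath θ a b
    via  : (m : Pos θ) → Child a m → Child m b →
           free (subAt θ b) ⊆ᵥ free (subAt θ m) → FlowPath θ a b

  data ∀ElimPath (θ : Formula) (y : Var) (a b : Pos θ) : Set where
    edge : Child a b → subAt θ a ≡ quant ∀Q y (subAt θ b) → ∀ElimPath θ y a b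
    via  : (m : Pos θ) → Child a m → Child m b → subAt θ a ≡ quant ∀Q y (subAt θ m) →
           free (subAt θ b) ⊆ᵥ free (subAt θ m) → ∀ElimPath θ y a b

  FlowPath-inQ : ∀ {q y φ a b} → FlowPath φ a b → FlowPath (quant q y φ) (inQ a) (inQ b)
  FlowPath-inQ (stay e) = stay (cong inQ e)
  FlowPath-inQ (edge c) = edge (q-step c)
  FlowPath-inQ (via m c₁ c₂ ⊆m) = via (inQ m) (q-step c₁) (q-step c₂) ⊆m

  FlowPath-inConj : ∀ {φs} j {a b} → FlowPath (lookupF φs j) a b →
                    FlowPath (conj φs) (inConj j a) (inConj j b)
  FlowPath-inConj j (stay e) = stay (cong (inConj j) e)
  FlowPath-inConj j (edge c) = edge (conj-step c)
  FlowPath-inConj j (via m c₁ c₂ ⊆m) = via (inConj j m) (conj-step c₁) (conj-step c₂) ⊆m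

  ∀ElimPath-inQ : ∀ {q y z φ a b} → ∀ElimPath φ z a b → ∀ElimPath (quant q y φ) z (inQ a) (inQ b)
  ∀ElimPath-inQ (edge c e) = edge (q-step c) e
  ∀ElimPath-inQ (via m c₁ c₂ e ⊆m) = via (inQ m) (q-step c₁) (q-step c₂) e ⊆m

  ∀ElimPath-inConj : ∀ {φs} j {z a b} → ∀ElimPath (lookupF φs j) z a b →
                     ∀ElimPath (conj φs) z (inConj j a) (inConj j b)
  ∀ElimPath-inConj j (edge c e) = edge (conj-step c) e
  ∀ElimPath-inConj j (via m c₁ c₂ e ⊆m) = via (inConj j m) (conj-step c₁) (conj-step c₂) e ⊆m

  record Simulation (θ′ θ : Formula) : Set where
    field
      σ      : Pos θ′ → Pos θ
      σ-root : σ here ≡ here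
      free-⊆ : ∀ p → free (subAt θ′ p) ⊆ᵥ free (subAt θ (σ p))
      atom-≡ : ∀ p {r vs eq} → subAt θ′ p ≡ atom r vs eq → subAt θ (σ p) ≡ atom r vs eq
      flow   : ∀ {p p′} → Child p p′ → FlowPath θ (σ p) (σ p′)
      ∀-elim : ∀ {p p′ y} → Child p p′ → subAt θ′ p ≡ quant ∀Q y (subAt θ′ p′) →
               ∀ElimPath θ y (σ p) (σ p′)

    root-free-⊆ : free θ′ ⊆ᵥ free θ
    root-free-⊆ = subst (λ p → free θ′ ⊆ᵥ free (subAt θ p)) σ-root (free-⊆ here)

  open Simulation

  Simulation-refl : ∀ {φ} → Simulation φ φ
  Simulation-refl = record
    { σ = λ p → p ; σ-root = refl ; free-⊆ = λ _ _ v∈ → v∈ ; atom-≡ = λ _ e → e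
    ; flow = edge ; ∀-elim = edge }

  Simulation-quant : ∀ q y {φ′ φ} → Simulation φ′ φ → Simulation (quant q y φ′) (quant q y φ)
  Simulation-quant q y {φ′} {φ} S = record
    { σ = σ⁺ ; σ-root = refl ; free-⊆ = free-⊆⁺ ; atom-≡ = atom-≡⁺ ; flow = flow⁺ ; ∀-elim = ∀-elim⁺ }
    where
      σ⁺ : Pos (quant q y φ′) → Pos (quant q y φ)
      σ⁺ here = here
      σ⁺ (inQ p) = inQ (σ S p)

      free-⊆⁺ : ∀ p → free (subAt (quant q y φ′) p) ⊆ᵥ free (subAt (quant q y φ) (σ⁺ p))
      free-⊆⁺ here = removeᵥ-mono y (free φ′) (free φ) (root-free-⊆ S)
      free-⊆⁺ (inQ p) = free-⊆ S p

      atom-≡⁺ : ∀ p {r vs eq} → subAt (quant q y φ′) p ≡ atom r vs eq →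
                subAt (quant q y φ) (σ⁺ p) ≡ atom r vs eq
      atom-≡⁺ here ()
      atom-≡⁺ (inQ p) = atom-≡ S p

      flow⁺ : ∀ {p p′} → Child p p′ → FlowPath (quant q y φ) (σ⁺ p) (σ⁺ p′)
      flow⁺ q-here rewrite σ-root S = edge q-here
      flow⁺ (q-step c) = FlowPath-inQ (flow S c)

      ∀-elim⁺ : ∀ {p p′ z} → Child p p′ →
                subAt (quant q y φ′) p ≡ quant ∀Q z (subAt (quant q y φ′) p′) →
                ∀ElimPath (quant q y φ) z (σ⁺ p) (σ⁺ p′)
      ∀-elim⁺ q-here e rewrite σ-root S = edge q-here (quant-prefix-≡ e)
      ∀-elim⁺ (q-step c) e = ∀ElimPath-inQ (∀-elim S c e)

  Conjunctwise : List Formula → List Formula → Set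
  Conjunctwise φs′ φs = (j : Fin (length φs′)) → ∃ λ j′ → Simulation (lookupF φs′ j) (lookupF φs j′)

  conjunctwise : ∀ {φs′ φs} → (∀ {φ′} → φ′ ∈ φs′ → ∃ λ φ → φ ∈ φs × Simulation φ′ φ) →
                 Conjunctwise φs′ φs
  conjunctwise {φs′} sim j =
    let φ , φ∈ , S = sim (lookupF-∈ φs′ j)
        j′ , e = ∈⇒lookupF φ∈
    in j′ , subst (Simulation (lookupF φs′ j)) (sym e) S

  Simulation-conj : ∀ {φs′ φs} → Conjunctwise φs′ φs → Simulation (conj φs′) (conj φs)
  Simulation-conj {φs′} {φs} sims = record
    { σ = σ⁺ ; σ-root = refl ; free-⊆ = free-⊆⁺ ; atom-≡ = atom-≡⁺ ; flow = flow⁺ ; ∀-elim = ∀-elim⁺ }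
    where
      ι : Fin (length φs′) → Fin (length φs)
      ι j = proj₁ (sims j)

      S : ∀ j → Simulation (lookupF φs′ j) (lookupF φs (ι j))
      S j = proj₂ (sims j)

      σ⁺ : Pos (conj φs′) → Pos (conj φs)
      σ⁺ here = here
      σ⁺ (inConj j p) = inConj (ι j) (σ (S j) p)

      free-⊆⁺ : ∀ p → free (subAt (conj φs′) p) ⊆ᵥ free (subAt (conj φs) (σ⁺ p))
      free-⊆⁺ here v v∈ =
        let j , v∈j = ∈ᵥ-freeList⁻ φs′ v∈ in free-lookupF-⊆ φs (ι j) v (root-free-⊆ (S j) v v∈j)
      free-⊆⁺ (inConj j p) = free-⊆ (S j) p

      atom-≡⁺ : ∀ p {r vs eq} → subAt (conj φs′) p ≡ atom r vs eq →
                subAt (conj φs) (σ⁺ p) ≡ atom r vs eq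
      atom-≡⁺ here ()
      atom-≡⁺ (inConj j p) = atom-≡ (S j) p

      flow⁺ : ∀ {p p′} → Child p p′ → FlowPath (conj φs) (σ⁺ p) (σ⁺ p′)
      flow⁺ (conj-here j) rewrite σ-root (S j) = edge (conj-here (ι j))
      flow⁺ (conj-step {j = j} c) = FlowPath-inConj (ι j) (flow (S j) c)

      ∀-elim⁺ : ∀ {p p′ z} → Child p p′ → subAt (conj φs′) p ≡ quant ∀Q z (subAt (conj φs′) p′) →
                ∀ElimPath (conj φs) z (σ⁺ p) (σ⁺ p′)
      ∀-elim⁺ (conj-here j) ()
      ∀-elim⁺ (conj-step {j = j} c) e = ∀ElimPath-inConj (ι j) (∀-elim (S j) c e)

  Simulation-subconj : ∀ {φs′ φs} → (∀ {φ} → φ ∈ φs′ → φ ∈ φs) → Simulation (conj φs′) (conj φs)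
  Simulation-subconj φs′⊆φs = Simulation-conj (conjunctwise (λ φ∈ → _ , φs′⊆φs φ∈ , Simulation-refl))

  Simulation-conjuncts : ∀ {φs′ θ} → ((j : Fin (length φs′)) → Simulation (lookupF φs′ j) θ) →
                         Simulation (conj φs′) θ
  Simulation-conjuncts {φs′} {θ} S = record
    { σ = σ⁺ ; σ-root = refl ; free-⊆ = free-⊆⁺ ; atom-≡ = atom-≡⁺ ; flow = flow⁺ ; ∀-elim = ∀-elim⁺ }
    where
      σ⁺ : Pos (conj φs′) → Pos θ
      σ⁺ here = here
      σ⁺ (inConj j p) = σ (S j) p

      free-⊆⁺ : ∀ p → free (subAt (conj φs′) p) ⊆ᵥ free (subAt θ (σ⁺ p))
      free-⊆⁺ here v v∈ = let j , v∈j = ∈ᵥ-freeList⁻ φs′ v∈ in root-free-⊆ (S j) v v∈j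
      free-⊆⁺ (inConj j p) = free-⊆ (S j) p

      atom-≡⁺ : ∀ p {r vs eq} → subAt (conj φs′) p ≡ atom r vs eq → subAt θ (σ⁺ p) ≡ atom r vs eq
      atom-≡⁺ here ()
      atom-≡⁺ (inConj j p) = atom-≡ (S j) p

      flow⁺ : ∀ {p p′} → Child p p′ → FlowPath θ (σ⁺ p) (σ⁺ p′)
      flow⁺ (conj-here j) = stay (sym (σ-root (S j)))
      flow⁺ (conj-step {j = j} c) = flow (S j) c

      ∀-elim⁺ : ∀ {p p′ z} → Child p p′ → subAt (conj φs′) p ≡ quant ∀Q z (subAt (conj φs′) p′) →
                ∀ElimPath θ z (σ⁺ p) (σ⁺ p′)
      ∀-elim⁺ (conj-here j) ()
      ∀-elim⁺ (conj-step {j = j} c) = ∀-elim (S j) c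

  -- Also for q = ∃Q, since judgement proofs have no ∃-specific rule.
  Simulation-quant-conjunct : ∀ q y φs j → Simulation (quant q y (lookupF φs j)) (quant q y (conj φs))
  Simulation-quant-conjunct q y φs j = record
    { σ = σ⁺ ; σ-root = refl ; free-⊆ = free-⊆⁺ ; atom-≡ = atom-≡⁺ ; flow = flow⁺ ; ∀-elim = ∀-elim⁺ }
    where
      φ θ : Formula
      φ = lookupF φs j
      θ = quant q y (conj φs)

      σ⁺ : Pos (quant q y φ) → Pos θ
      σ⁺ here = here
      σ⁺ (inQ p) = inQ (inConj j p)

      free-⊆⁺ : ∀ p → free (subAt (quant q y φ) p) ⊆ᵥ free (subAt θ (σ⁺ p))
      free-⊆⁺ here = removeᵥ-mono y (free φ) (freeList φs) (free-lookupF-⊆ φs j)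
      free-⊆⁺ (inQ p) _ v∈ = v∈

      atom-≡⁺ : ∀ p {r vs eq} → subAt (quant q y φ) p ≡ atom r vs eq → subAt θ (σ⁺ p) ≡ atom r vs eq
      atom-≡⁺ here ()
      atom-≡⁺ (inQ p) e = e

      flow⁺ : ∀ {p p′} → Child p p′ → FlowPath θ (σ⁺ p) (σ⁺ p′)
      flow⁺ q-here = via (inQ here) q-here (q-step (conj-here j)) (free-lookupF-⊆ φs j)
      flow⁺ (q-step c) = edge (q-step (conj-step c))

      ∀-elim⁺ : ∀ {p p′ z} → Child p p′ → subAt (quant q y φ) p ≡ quant ∀Q z (subAt (quant q y φ) p′) →
                ∀ElimPath θ z (σ⁺ p) (σ⁺ p′)
      ∀-elim⁺ q-here e =
        via (inQ here) q-here (q-step (conj-here j)) (quant-prefix-≡ e) (free-lookupF-⊆ φs j)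
      ∀-elim⁺ (q-step c) e = edge (q-step (conj-step c)) e

  Simulation-pullOut : ∀ q v φ ψ → ¬ v ∈ᵥ free ψ →
                       Simulation (conj (quant q v φ ∷ ψ ∷ [])) (quant q v (conj (φ ∷ ψ ∷ [])))
  Simulation-pullOut q v φ ψ v∉ψ = record
    { σ = σ⁺ ; σ-root = refl ; free-⊆ = free-⊆⁺ ; atom-≡ = atom-≡⁺ ; flow = flow⁺ ; ∀-elim = ∀-elim⁺ }
    where
      φs : List Formula
      φs = φ ∷ ψ ∷ []

      θ′ θ : Formula
      θ′ = conj (quant q v φ ∷ ψ ∷ [])
      θ = quant q v (conj φs)

      S₀ : Simulation (quant q v φ) θ
      S₀ = Simulation-quant-conjunct q v φs zero

      free-ψ-⊆ : free ψ ⊆ᵥ free (conj φs)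
      free-ψ-⊆ = free-lookupF-⊆ φs (suc zero)

      σ⁺ : Pos θ′ → Pos θ
      σ⁺ here = here
      σ⁺ (inConj zero p) = σ S₀ p
      σ⁺ (inConj (suc zero) p) = inQ (inConj (suc zero) p)

      free-⊆⁺ : ∀ p → free (subAt θ′ p) ⊆ᵥ free (subAt θ (σ⁺ p))
      free-⊆⁺ here w w∈ with ∈ᵥ-freeList⁻ (quant q v φ ∷ ψ ∷ []) w∈
      ... | zero , w∈₀ = root-free-⊆ S₀ w w∈₀
      ... | suc zero , w∈ψ =
        ∈ᵥ-removeᵥ⁺ v (free (conj φs)) (free-ψ-⊆ w w∈ψ) (λ { refl → v∉ψ w∈ψ })
      free-⊆⁺ (inConj zero p) = free-⊆ S₀ p
      free-⊆⁺ (inConj (suc zero) p) _ w∈ = w∈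

      atom-≡⁺ : ∀ p {r vs eq} → subAt θ′ p ≡ atom r vs eq → subAt θ (σ⁺ p) ≡ atom r vs eq
      atom-≡⁺ here ()
      atom-≡⁺ (inConj zero p) = atom-≡ S₀ p
      atom-≡⁺ (inConj (suc zero) p) e = e

      flow⁺ : ∀ {p p′} → Child p p′ → FlowPath θ (σ⁺ p) (σ⁺ p′)
      flow⁺ (conj-here zero) = stay refl
      flow⁺ (conj-here (suc zero)) = via (inQ here) q-here (q-step (conj-here (suc zero))) free-ψ-⊆
      flow⁺ (conj-step {j = zero} c) = flow S₀ c
      flow⁺ (conj-step {j = suc zero} c) = edge (q-step (conj-step c))

      ∀-elim⁺ : ∀ {p p′ z} → Child p p′ → subAt θ′ p ≡ quant ∀Q z (subAt θ′ p′) →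
                ∀ElimPath θ z (σ⁺ p) (σ⁺ p′)
      ∀-elim⁺ (conj-here _) ()
      ∀-elim⁺ (conj-step {j = zero} c) = ∀-elim S₀ c
      ∀-elim⁺ (conj-step {j = suc zero} c) = edge (q-step (conj-step c))

  Simulation-distrib : ∀ y φs → Simulation (conj (map (quant ∀Q y) φs)) (quant ∀Q y (conj φs))
  Simulation-distrib y φs = Simulation-conjuncts λ j →
    let j′ , e = lookupF-map (quant ∀Q y) φs j
    in subst (λ χ → Simulation χ _) (sym e) (Simulation-quant-conjunct ∀Q y φs j′)

  Simulation-inContext : ∀ xs ys {φ ψ} → Simulation ψ φ →
                         Simulation (conj (xs ++ ψ ∷ ys)) (conj (xs ++ φ ∷ ys))
  Simulation-inContext xs ys {φ} S = Simulation-conj (conjunctwise sim)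
    where
      sim : ∀ {χ} → χ ∈ xs ++ _ ∷ ys → ∃ λ χ′ → χ′ ∈ xs ++ φ ∷ ys × Simulation χ χ′
      sim χ∈ with ∈-++⁻ xs χ∈
      ... | inj₁ χ∈xs = _ , ∈-++⁺ˡ χ∈xs , Simulation-refl
      ... | inj₂ (here refl) = φ , ∈-++⁺ʳ xs (here refl) , S
      ... | inj₂ (there χ∈ys) = _ , ∈-++⁺ʳ xs (there χ∈ys) , Simulation-refl

  transform⇒Simulation : ∀ {θ θ′} → Transform θ θ′ → Simulation θ′ θ
  transform⇒Simulation (split {φs} {φJ} {φK} φs↭) =
    Simulation-conjuncts λ where
      zero → Simulation-subconj (λ φ∈ → ∈-resp-↭ (↭-sym φs↭) (∈-++⁺ˡ φ∈))
      (suc zero) → Simulation-subconj (λ φ∈ → ∈-resp-↭ (↭-sym φs↭) (∈-++⁺ʳ φJ φ∈))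
  transform⇒Simulation (pullOut q v φ ψ v∉ψ) = Simulation-pullOut q v φ ψ v∉ψ
  transform⇒Simulation (distrib y φs) = Simulation-distrib y φs

  rewrite⇒Simulation : ∀ {θ θ′} → Rewrite θ θ′ → Simulation θ′ θ
  rewrite⇒Simulation (root t) = transform⇒Simulation t
  rewrite⇒Simulation (inConjR xs ys r) = Simulation-inContext xs ys (rewrite⇒Simulation r)
  rewrite⇒Simulation (inQR q y r) = Simulation-quant q y (rewrite⇒Simulation r)

  module Replay {θ′ θ : Formula} (S : Simulation θ′ θ) (B : Structure) (k : ℕ) where
    Narrow : ∀ {φ} → Judgement φ B → Set
    Narrow J = width (vars J) ≤ k

    data _≈_ : Judgement θ′ B → Judgement θ B → Set₁ where
      ≈-intro : ∀ {p′ p V wf′ wf F} → p ≡ σ S p′ → judgement p′ V wf′ F ≈ judgement p V wf F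

    record Replayed (js′ : List (Judgement θ′ B)) : Set₁ where
      field
        js      : List (Judgement θ B)
        proof   : Proof θ B js
        narrow  : All Narrow js
        replays : ∀ {J′} → J′ ∈ js′ → ∃ λ J → J ∈ js × J′ ≈ J
    open Replayed

    σ-wf : ∀ p V → V ⊆ᵥ free (subAt θ′ p) → V ⊆ᵥ free (subAt θ (σ S p))
    σ-wf p V wf v v∈ = free-⊆ S p v (wf v v∈)

    emit : ∀ {js′ J′ J} (R : Replayed js′) → Step θ B (js R) J → Narrow J → J′ ≈ J →
           Replayed (J′ ∷ js′)
    emit {J = J} R s w J′≈J = record
      { js = J ∷ js R ; proof = proof R ▷ s ; narrow = w ∷ narrow R ; replays = replays′ }
      where
        replays′ : ∀ {J″} → J″ ∈ _ → ∃ λ J₀ → J₀ ∈ J ∷ js R × J″ ≈ J₀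
        replays′ (here refl) = J , here refl , J′≈J
        replays′ (there J″∈) = let J₀ , J₀∈ , ≈J₀ = replays R J″∈ in J₀ , there J₀∈ , ≈J₀

    emitAux : ∀ {js′ J} (R : Replayed js′) → Step θ B (js R) J → Narrow J → Replayed js′
    emitAux {J = J} R s w = record
      { js = J ∷ js R ; proof = proof R ▷ s ; narrow = w ∷ narrow R ; replays = replays′ }
      where
        replays′ : ∀ {J″} → J″ ∈ _ → ∃ λ J₀ → J₀ ∈ J ∷ js R × J″ ≈ J₀
        replays′ J″∈ = let J₀ , J₀∈ , ≈J₀ = replays R J″∈ in J₀ , there J₀∈ , ≈J₀

    reuse : ∀ {js′ J′ J} (R : Replayed js′) → J ∈ js R → J′ ≈ J → Replayed (J′ ∷ js′)
    reuse {J = J} R J∈ J′≈J = record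
      { js = js R ; proof = proof R ; narrow = narrow R ; replays = replays′ }
      where
        replays′ : ∀ {J″} → J″ ∈ _ → ∃ λ J₀ → J₀ ∈ js R × J″ ≈ J₀
        replays′ (here refl) = J , J∈ , J′≈J
        replays′ (there J″∈) = replays R J″∈

    replay-step : ∀ {js′ J′} (R : Replayed js′) → Step θ′ B js′ J′ → Narrow J′ → Replayed (J′ ∷ js′)
    replay-step R (atomS i r vs eq e wf) w =
      emit R (atomS (σ S i) r vs eq (atom-≡ S i e) (σ-wf i vs wf)) w (≈-intro refl)
    replay-step R (projS J′∈ W W⊆V wf) w with replays R J′∈
    ... | _ , J∈ , ≈-intro {p′} refl = emit R (projS J∈ W W⊆V (σ-wf p′ W wf)) w (≈-intro refl)
    replay-step R (joinS J₁′∈ J₂′∈ same wf) w with replays R J₁′∈ | replays R J₂′∈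
    ... | _ , J₁∈ , ≈-intro {p′} {V = V₁} refl | _ , J₂∈ , ≈-intro {V = V₂} refl =
      emit R (joinS J₁∈ J₂∈ (cong (σ S) same) (σ-wf p′ (V₁ ++ V₂) wf)) w (≈-intro refl)
    replay-step R (upS J′∈ i c wf) w with replays R J′∈
    ... | _ , J∈ , ≈-intro {p′} {V = V} {wf′} refl with flow S c
    ...   | stay e = reuse R J∈ (≈-intro (sym e))
    ...   | edge c′ = emit R (upS J∈ (σ S i) c′ (σ-wf i V wf)) w (≈-intro refl)
    ...   | via m c₁ c₂ ⊆m =
      emit (emitAux R (upS J∈ m c₂ (λ v v∈ → ⊆m v (σ-wf p′ V wf′ v v∈))) w)
           (upS (here refl) (σ S i) c₁ (σ-wf i V wf)) w (≈-intro refl)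
    replay-step R (downS J′∈ j c wf) w with replays R J′∈
    ... | _ , J∈ , ≈-intro {V = V} refl with flow S c
    ...   | stay e = reuse R J∈ (≈-intro e)
    ...   | edge c′ = emit R (downS J∈ (σ S j) c′ (σ-wf j V wf)) w (≈-intro refl)
    ...   | via m c₁ c₂ ⊆m =
      emit (emitAux R (downS J∈ m c₁ (λ v v∈ → ⊆m v (σ-wf j V wf v v∈))) w)
           (downS (here refl) (σ S j) c₂ (σ-wf j V wf)) w (≈-intro refl)
    replay-step R (∀elimS J′∈ i c y e y∈ wf) w with replays R J′∈
    ... | _ , J∈ , ≈-intro {p′} {V = V} {wf′} refl with ∀-elim S c e
    ...   | edge c′ e′ =
      emit R (∀elimS J∈ (σ S i) c′ y e′ y∈ (σ-wf i (removeᵥ y V) wf)) w (≈-intro refl)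
    ...   | via m c₁ c₂ e′ ⊆m =
      emit (emitAux R (upS J∈ m c₂ (λ v v∈ → ⊆m v (σ-wf p′ V wf′ v v∈))) (All.lookup (narrow R) J∈))
           (∀elimS (here refl) (σ S i) c₁ y e′ y∈ (σ-wf i (removeᵥ y V) wf)) w (≈-intro refl)

    replay : ∀ {js′} → Proof θ′ B js′ → All Narrow js′ → Replayed js′
    replay [] [] = record { js = [] ; proof = [] ; narrow = [] ; replays = λ () }
    replay (P ▷ s) (w ∷ ws) = replay-step (replay P ws) s w

    ≈-EmptyJ : ∀ {J′ J} → J′ ≈ J → EmptyJ θ′ B J′ → EmptyJ θ B J
    ≈-EmptyJ (≈-intro _) empty = empty

    judgeConsistent-transfer : JudgeConsistent θ B k → JudgeConsistent θ′ B k
    judgeConsistent-transfer consistent js′ P′ narrow′ someEmpty′ =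
      let R = replay P′ narrow′
          J′ , J′∈ , empty′ = find someEmpty′
          J , J∈ , J′≈J = replays R J′∈
      in consistent (js R) (proof R) (narrow R) (lose J∈ (≈-EmptyJ J′≈J empty′))

-- The replay keeps V and F unchanged and never inspects B.
lemma5p6 : (sig : Signature) → let open QCSP sig in
    (k : ℕ) → 1 ≤ k →
    (θ θ' : Formula) (B : Structure) →
    Sentence θ → Finite B →
    JudgeConsistent θ B k →
    Rewrite θ θ' →
    JudgeConsistent θ' B k
lemma5p6 sig k _ θ θ' B _ _ consistent r =
  Replay.judgeConsistent-transfer sig (rewrite⇒Simulation sig r) B k consistent
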